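{- Let $a$ be any complex number. For every nonnegative integer $n$, $$\sum_{k=0}^n\binom ak\binom{ -1-a}k\binom a{n-k}\binom{ -1-a}{n-k}=\sum_{k=0}^n\binom{2k}k\binom ak\binom{ -1-a}k\binom k{n-k}(-1)^{n-k}.$$
   Context: For a number $a$ and an integer $k\ge 0$, $\binom{a}{k}=a(a-1)\cdots(a-k+1)/k!$; for nonnegative integers $k$ and $j$, $\binom kj=0$ when $j>k$. -}

module Defs where

open import Level using (Level)
open import Data.Nat using (ℕ; zero; suc)
open import Algebra.Bundles using (CommutativeRing)

module Ops {c ℓ : Level} (R : CommutativeRing c ℓ) where
  open CommutativeRing R hiding (zero)

  natR : ℕ → Carrier
  natR zero    = 0#
  natR (suc n) = 1# + natR n

  pow : Carrier → ℕ → Carrier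
  pow x zero    = 1#
  pow x (suc n) = x * pow x n

  sumTo : ℕ → (ℕ → Carrier) → Carrier
  sumTo zero    f = f zero
  sumTo (suc n) f = sumTo n f + f (suc n)

  falling : Carrier → ℕ → Carrier
  falling a zero    = 1#
  falling a (suc k) = falling a k * (a - natR k)

  -- Given inv with inv i = 1/(i+1), invFact inv k = 1/k!
  invFact : (ℕ → Carrier) → ℕ → Carrier
  invFact inv zero    = 1#
  invFact inv (suc k) = invFact inv k * inv k

  binom : (ℕ → Carrier) → Carrier → ℕ → Carrier
  binom inv a k = falling a k * invFact inv k

  -- The ring is a Q-algebra: every positive integer is invertible, inv i = (i+1)⁻¹
  IsInvNat : (ℕ → Carrier) → Set ℓ
  IsInvNat inv = ∀ i → inv i * natR (suc i) ≈ 1#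

module Submission where

open import Defs
open import Level using (Level)
open import Data.Nat using (ℕ; _∸_) renaming (_*_ to _*ℕ_)
open import Data.Nat.Combinatorics using (_C_)
open import Algebra.Bundles using (CommutativeRing)

-- Let b = -1 - a, Λ = a² + a and u(k) = binom(a, k) binom(b, k); then
-- (k+1)² u(k+1) = (k² + k - Λ) u(k).  The theorem says that the convolution
--   P(n) = Σ_k u(k) u(n-k)
-- equals
--   r(n) = Σ_k C(2k, k) u(k) C(k, n-k) (-1)ⁿ⁻ᵏ,
-- the coefficient of xⁿ in Σ_k C(2k, k) u(k) (x - x²)ᵏ (a Clausen-type identity).
--
-- Both sides are shown to satisfy the same three-term recurrence
--   (n+2)³ y(n+2) = (2m+1)(m(m+1) - 2Λ) y(n+1) - m(m² - 1 - 4Λ) y(n),   m = n+1,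
-- with y(0) = 1 and y(1) = 2 u(1); since the leading coefficient is an
-- invertible integer, this determines y.
--  * For P, the moments Q, S, T of orders 1, 2, 3 of the convolution satisfy
--    symmetry relations (k ↦ n - k) and index-shift relations (from the
--    recurrence of u); eliminating Q and T gives the recurrence.
--  * For r, the recurrence follows by creative telescoping: the recurrence
--    operator applied to the summand is a difference in k, using a
--    first-order relation between the coefficients [xⁿ] (x - x²)ᵏ.

module BinomialCoefficients where

  open import Data.Nat
  open import Data.Nat.Properties
  open import Data.Nat.Combinatorics
    using (_C_; nC1≡n; k>n⇒nCk≡0; nCk+nC[k+1]≡[n+1]C[k+1]; nCk≡nC[n∸k])
  open import Relation.Binary.PropositionalEquality
  open ≡-Reasoning

  C-absorb : ∀ n k → suc k * (suc n C suc k) ≡ suc n * (n C k)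
  C-absorb zero    zero    = refl
  C-absorb zero    (suc k) =
    trans (cong (suc (suc k) *_) (k>n⇒nCk≡0 {1} {suc (suc k)} (s≤s (s≤s z≤n))))
          (*-zeroʳ (suc (suc k)))
  C-absorb (suc n) zero    = trans (*-identityˡ _) (trans (nC1≡n (suc (suc n))) (sym (*-identityʳ _)))
  C-absorb (suc n) (suc k) = begin
    suc (suc k) * (suc (suc n) C suc (suc k))
      ≡⟨ cong (suc (suc k) *_) (nCk+nC[k+1]≡[n+1]C[k+1] (suc n) (suc k)) ⟨
    suc (suc k) * (A + suc n C suc (suc k))
      ≡⟨ *-distribˡ-+ (suc (suc k)) A _ ⟩
    (A + suc k * A) + suc (suc k) * (suc n C suc (suc k))
      ≡⟨ cong₂ (λ x y → (A + x) + y) (C-absorb n k) (C-absorb n (suc k)) ⟩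
    (A + suc n * (n C k)) + suc n * (n C suc k)
      ≡⟨ +-assoc A _ _ ⟩
    A + (suc n * (n C k) + suc n * (n C suc k))
      ≡⟨ cong (A +_) (*-distribˡ-+ (suc n) (n C k) (n C suc k)) ⟨
    A + suc n * (n C k + n C suc k)
      ≡⟨ cong (λ x → A + suc n * x) (nCk+nC[k+1]≡[n+1]C[k+1] n k) ⟩
    suc (suc n) * A ∎
    where A = suc n C suc k

  C-central : ∀ k → suc k * ((2 * suc k) C suc k) ≡ 2 * suc (2 * k) * ((2 * k) C k)
  C-central k = begin
    suc k * ((2 * suc k) C suc k)
      ≡⟨ cong (λ m → suc k * (m C suc k)) (*-suc 2 k) ⟩
    suc k * (suc D C suc k)
      ≡⟨ cong (suc k *_) (nCk+nC[k+1]≡[n+1]C[k+1] D k) ⟨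
    suc k * (D C k + D C suc k)
      ≡⟨ cong (λ x → suc k * (x + D C suc k)) middle-symmetric ⟩
    suc k * (D C suc k + D C suc k)
      ≡⟨ *-distribˡ-+ (suc k) (D C suc k) _ ⟩
    suc k * (D C suc k) + suc k * (D C suc k)
      ≡⟨ cong₂ _+_ (C-absorb (2 * k) k) (C-absorb (2 * k) k) ⟩
    D * ((2 * k) C k) + D * ((2 * k) C k)
      ≡⟨ cong (D * ((2 * k) C k) +_) (+-identityʳ _) ⟨
    2 * (D * ((2 * k) C k))
      ≡⟨ *-assoc 2 D _ ⟨
    2 * D * ((2 * k) C k) ∎
    where
    D = suc (2 * k)
    k≤2k : k ≤ 2 * k
    k≤2k = m≤m+n k (k + 0)
    middle-symmetric : D C k ≡ D C suc k
    middle-symmetric = begin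
      D C k                ≡⟨ nCk≡nC[n∸k] (m≤n⇒m≤1+n k≤2k) ⟩
      D C (D ∸ k)          ≡⟨ cong (D C_) (+-∸-assoc 1 k≤2k) ⟩
      D C suc (2 * k ∸ k)  ≡⟨ cong (λ m → D C suc m) (trans (m+n∸m≡n k (k + 0)) (+-identityʳ k)) ⟩
      D C suc k            ∎

module IntegerRingSolver {c ℓ : Level} (R : CommutativeRing c ℓ) where

  open import Data.Nat as ℕ using (ℕ; zero; suc)
  import Data.Nat.Properties as ℕ
  open import Data.Integer as ℤ using (ℤ; +_; -[1+_]; _⊖_)
  import Data.Integer.Properties as ℤ
  open import Data.Sign as Sign using (Sign)
  open import Data.Maybe using (Maybe; just; nothing)
  open import Relation.Nullary using (yes; no)
  import Relation.Binary.PropositionalEquality as ≡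
  open import Algebra.Solver.Ring.AlmostCommutativeRing

  open CommutativeRing R
  open import Algebra.Properties.Ring ring
    using (-‿involutive; -‿+-comm; -0#≈0#; -1*x≈-x)
  open import Algebra.Properties.Semiring.Mult.TCOptimised semiring
    using (_×_; 1+×; ×-homo-+; ×1-homo-*)
  open import Algebra.Properties.CommutativeSemigroup *-commutativeSemigroup
    using (interchange)
  open import Relation.Binary.Reasoning.Setoid setoid

  ι : ℤ → Carrier
  ι (+ n)    = n × 1#
  ι -[1+ n ] = - (suc n × 1#)

  -- Small constants; they are definitionally the values of the solver's
  -- constants con (+ n).
  2# 3# 4# 6# : Carrier
  2# = ι (+ 2)
  3# = ι (+ 3)
  4# = ι (+ 4)
  6# = ι (+ 6)

  -- ι is additive; integer addition is defined through m ⊖ n = m - n.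
  ι-⊖ : ∀ m n → ι (m ⊖ n) ≈ m × 1# - n × 1#
  ι-⊖ m       zero    = sym (trans (+-congˡ -0#≈0#) (+-identityʳ _))
  ι-⊖ zero    (suc n) = sym (+-identityˡ _)
  ι-⊖ (suc m) (suc n) = begin
    ι (suc m ⊖ suc n)                ≡⟨ ≡.cong ι (ℤ.[1+m]⊖[1+n]≡m⊖n m n) ⟩
    ι (m ⊖ n)                        ≈⟨ ι-⊖ m n ⟩
    m × 1# - n × 1#                  ≈⟨ cancel-1# (m × 1#) (n × 1#) ⟩
    (1# + m × 1#) - (1# + n × 1#)    ≈⟨ +-cong (1+× m 1#) (-‿cong (1+× n 1#)) ⟨
    suc m × 1# - suc n × 1#          ∎
    where
    cancel-1# : ∀ x y → x - y ≈ (1# + x) - (1# + y)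
    cancel-1# x y = begin
      x - y                    ≈⟨ +-identityˡ _ ⟨
      0# + (x - y)             ≈⟨ +-congʳ (-‿inverseʳ 1#) ⟨
      (1# - 1#) + (x - y)      ≈⟨ +-assoc 1# (- 1#) (x - y) ⟩
      1# + (- 1# + (x - y))    ≈⟨ +-congˡ (+-assoc (- 1#) x (- y)) ⟨
      1# + ((- 1# + x) - y)    ≈⟨ +-congˡ (+-congʳ (+-comm (- 1#) x)) ⟩
      1# + ((x - 1#) - y)      ≈⟨ +-congˡ (+-assoc x (- 1#) (- y)) ⟩
      1# + (x + (- 1# - y))    ≈⟨ +-congˡ (+-congˡ (-‿+-comm 1# y)) ⟩
      1# + (x - (1# + y))      ≈⟨ +-assoc 1# x _ ⟨
      (1# + x) - (1# + y)      ∎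

  ι-+ : ∀ i j → ι (i ℤ.+ j) ≈ ι i + ι j
  ι-+ (+ m)    (+ n)    = ×-homo-+ 1# m n
  ι-+ (+ m)    -[1+ n ] = ι-⊖ m (suc n)
  ι-+ -[1+ m ] (+ n)    = trans (ι-⊖ n (suc m)) (+-comm _ _)
  ι-+ -[1+ m ] -[1+ n ] = begin
    - (suc (suc (m ℕ.+ n)) × 1#)      ≡⟨ ≡.cong (λ t → - (suc t × 1#)) (≡.sym (ℕ.+-suc m n)) ⟩
    - ((suc m ℕ.+ suc n) × 1#)        ≈⟨ -‿cong (×-homo-+ 1# (suc m) (suc n)) ⟩
    - (suc m × 1# + suc n × 1#)       ≈⟨ -‿+-comm _ _ ⟨
    - (suc m × 1#) - suc n × 1#       ∎

  -- ι is multiplicative; integer multiplication is defined through signs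
  -- and absolute values, and signs act as ±1.
  σ : Sign → Carrier
  σ Sign.+ = 1#
  σ Sign.- = - 1#

  σ-* : ∀ s t → σ (s Sign.* t) ≈ σ s * σ t
  σ-* Sign.+ t      = sym (*-identityˡ _)
  σ-* Sign.- Sign.+ = sym (*-identityʳ _)
  σ-* Sign.- Sign.- = begin
    1#            ≈⟨ -‿involutive 1# ⟨
    - - 1#        ≈⟨ -1*x≈-x (- 1#) ⟨
    - 1# * - 1#   ∎

  ι-◃ : ∀ s n → ι (s ℤ.◃ n) ≈ σ s * (n × 1#)
  ι-◃ s      zero    = sym (zeroʳ _)
  ι-◃ Sign.+ (suc n) = sym (*-identityˡ _)
  ι-◃ Sign.- (suc n) = sym (-1*x≈-x _)

  ι-signAbs : ∀ i → ι i ≈ σ (ℤ.sign i) * (ℤ.∣ i ∣ × 1#)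
  ι-signAbs (+ n)    = sym (*-identityˡ _)
  ι-signAbs -[1+ n ] = sym (-1*x≈-x _)

  ι-* : ∀ i j → ι (i ℤ.* j) ≈ ι i * ι j
  ι-* i j = begin
    ι (i ℤ.* j)
      ≈⟨ ι-◃ (ℤ.sign i Sign.* ℤ.sign j) (ℤ.∣ i ∣ ℕ.* ℤ.∣ j ∣) ⟩
    σ (ℤ.sign i Sign.* ℤ.sign j) * ((ℤ.∣ i ∣ ℕ.* ℤ.∣ j ∣) × 1#)
      ≈⟨ *-cong (σ-* (ℤ.sign i) (ℤ.sign j)) (×1-homo-* ℤ.∣ i ∣ ℤ.∣ j ∣) ⟩
    (s * t) * (m * n)
      ≈⟨ interchange s t m n ⟩
    (s * m) * (t * n)
      ≈⟨ *-cong (ι-signAbs i) (ι-signAbs j) ⟨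
    ι i * ι j ∎
    where
    s = σ (ℤ.sign i)
    t = σ (ℤ.sign j)
    m = ℤ.∣ i ∣ × 1#
    n = ℤ.∣ j ∣ × 1#

  ι-neg : ∀ i → ι (ℤ.- i) ≈ - ι i
  ι-neg (+ zero)  = sym -0#≈0#
  ι-neg (+ suc n) = refl
  ι-neg -[1+ n ]  = sym (-‿involutive _)

  ι-morphism : ℤ.+-*-rawRing -Raw-AlmostCommutative⟶ fromCommutativeRing R
  ι-morphism = record
    { ⟦_⟧    = ι
    ; +-homo = ι-+
    ; *-homo = ι-*
    ; -‿homo = ι-neg
    ; 0-homo = refl
    ; 1-homo = refl
    }

  ι-≟ : ∀ i j → Maybe (ι i ≈ ι j)
  ι-≟ i j with i ℤ.≟ j
  ... | yes ≡.refl = just refl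
  ... | no _       = nothing

  open import Algebra.Solver.Ring ℤ.+-*-rawRing (fromCommutativeRing R) ι-morphism ι-≟ public

  κ : ∀ {m} → ℕ → Polynomial m
  κ n = con (+ n)

  -- To prove x ≈ y it suffices to exhibit x - y (by the solver) as a
  -- combination of quantities known to vanish; these facts package that
  -- pattern.
  ≈-fromDifference : ∀ {x y} → x - y ≈ 0# → x ≈ y
  ≈-fromDifference {x} {y} x-y≈0 = begin
    x                ≈⟨ solve 2 (λ x y → x := (x :- y) :+ y) refl x y ⟩
    (x - y) + y      ≈⟨ +-congʳ x-y≈0 ⟩
    0# + y           ≈⟨ +-identityˡ y ⟩
    y                ∎

  scaledDifference≈0 : ∀ z {x y} → x ≈ y → z * (x - y) ≈ 0#
  scaledDifference≈0 z {y = y} x≈y =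
    trans (*-congˡ (trans (+-congʳ x≈y) (-‿inverseʳ y))) (zeroʳ z)

  scaled≈0 : ∀ z {x} → x ≈ 0# → z * x ≈ 0#
  scaled≈0 z x≈0 = trans (*-congˡ x≈0) (zeroʳ z)

module FiniteSums {c ℓ : Level} (R : CommutativeRing c ℓ) where

  open import Data.Nat as ℕ using (ℕ; zero; suc; _∸_; _≤_; z≤n)
  import Data.Nat.Properties as ℕ
  import Relation.Binary.PropositionalEquality as ≡

  open CommutativeRing R
  open Ops R
  open import Algebra.Properties.Ring ring using (-‿+-comm)
  open import Algebra.Properties.CommutativeSemigroup +-commutativeSemigroup
    using (interchange)
  open import Relation.Binary.Reasoning.Setoid setoid

  sumTo-cong≤ : ∀ n {f g : ℕ → Carrier} → (∀ k → k ≤ n → f k ≈ g k) →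
                sumTo n f ≈ sumTo n g
  sumTo-cong≤ zero    f≈g = f≈g 0 z≤n
  sumTo-cong≤ (suc n) f≈g =
    +-cong (sumTo-cong≤ n (λ k k≤n → f≈g k (ℕ.m≤n⇒m≤1+n k≤n))) (f≈g (suc n) ℕ.≤-refl)

  sumTo-cong : ∀ n {f g : ℕ → Carrier} → (∀ k → f k ≈ g k) → sumTo n f ≈ sumTo n g
  sumTo-cong n f≈g = sumTo-cong≤ n (λ k _ → f≈g k)

  sumTo-+ : ∀ n (f g : ℕ → Carrier) →
            sumTo n (λ k → f k + g k) ≈ sumTo n f + sumTo n g
  sumTo-+ zero    f g = refl
  sumTo-+ (suc n) f g = trans (+-congʳ (sumTo-+ n f g)) (interchange _ _ _ _)

  sumTo-*ˡ : ∀ n x (f : ℕ → Carrier) → sumTo n (λ k → x * f k) ≈ x * sumTo n f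
  sumTo-*ˡ zero    x f = refl
  sumTo-*ˡ (suc n) x f = trans (+-congʳ (sumTo-*ˡ n x f)) (sym (distribˡ x _ _))

  sumTo-- : ∀ n (f g : ℕ → Carrier) →
            sumTo n (λ k → f k - g k) ≈ sumTo n f - sumTo n g
  sumTo-- zero    f g = refl
  sumTo-- (suc n) f g = begin
    sumTo n (λ k → f k - g k) + (f (suc n) - g (suc n))
      ≈⟨ +-congʳ (sumTo-- n f g) ⟩
    (sumTo n f - sumTo n g) + (f (suc n) - g (suc n))
      ≈⟨ interchange _ _ _ _ ⟩
    (sumTo n f + f (suc n)) + (- sumTo n g - g (suc n))
      ≈⟨ +-congˡ (-‿+-comm _ _) ⟩
    (sumTo n f + f (suc n)) - (sumTo n g + g (suc n)) ∎

  sumTo-linear₃ : ∀ n (α β γ : Carrier) (f g h : ℕ → Carrier) →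
                  sumTo n (λ k → α * f k + β * g k + γ * h k)
                  ≈ α * sumTo n f + β * sumTo n g + γ * sumTo n h
  sumTo-linear₃ n α β γ f g h = begin
    sumTo n (λ k → α * f k + β * g k + γ * h k)
      ≈⟨ sumTo-+ n _ _ ⟩
    sumTo n (λ k → α * f k + β * g k) + sumTo n (λ k → γ * h k)
      ≈⟨ +-cong (sumTo-+ n _ _) (sumTo-*ˡ n γ h) ⟩
    sumTo n (λ k → α * f k) + sumTo n (λ k → β * g k) + γ * sumTo n h
      ≈⟨ +-congʳ (+-cong (sumTo-*ˡ n α f) (sumTo-*ˡ n β g)) ⟩
    α * sumTo n f + β * sumTo n g + γ * sumTo n h ∎

  sumTo-shift : ∀ n (f : ℕ → Carrier) → sumTo (suc n) f ≈ f 0 + sumTo n (λ k → f (suc k))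
  sumTo-shift zero    f = refl
  sumTo-shift (suc n) f = trans (+-congʳ (sumTo-shift n f)) (+-assoc _ _ _)

  sumTo-reverse : ∀ n (f : ℕ → Carrier) → sumTo n f ≈ sumTo n (λ k → f (n ∸ k))
  sumTo-reverse zero    f = refl
  sumTo-reverse (suc n) f = begin
    sumTo n f + f (suc n)                    ≈⟨ +-comm _ _ ⟩
    f (suc n) + sumTo n f                    ≈⟨ +-congˡ (sumTo-reverse n f) ⟩
    f (suc n) + sumTo n (λ k → f (n ∸ k))    ≈⟨ sumTo-shift n (λ k → f (suc n ∸ k)) ⟨
    sumTo (suc n) (λ k → f (suc n ∸ k))      ∎

  sumTo-telescope : ∀ n (g : ℕ → Carrier) →
                    sumTo n (λ k → g (suc k) - g k) ≈ g (suc n) - g 0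
  sumTo-telescope zero    g = refl
  sumTo-telescope (suc n) g = begin
    sumTo n (λ k → g (suc k) - g k) + (g (suc (suc n)) - g (suc n))
      ≈⟨ +-congʳ (sumTo-telescope n g) ⟩
    (g (suc n) - g 0) + (g (suc (suc n)) - g (suc n))
      ≈⟨ +-comm _ _ ⟩
    (g (suc (suc n)) - g (suc n)) + (g (suc n) - g 0)
      ≈⟨ +-assoc _ _ _ ⟩
    g (suc (suc n)) + (- g (suc n) + (g (suc n) - g 0))
      ≈⟨ +-congˡ (+-assoc _ _ _) ⟨
    g (suc (suc n)) + ((- g (suc n) + g (suc n)) - g 0)
      ≈⟨ +-congˡ (+-congʳ (-‿inverseˡ _)) ⟩
    g (suc (suc n)) + (0# - g 0)
      ≈⟨ +-congˡ (+-identityˡ _) ⟩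
    g (suc (suc n)) - g 0 ∎

  sumTo-dropLast : ∀ n (f : ℕ → Carrier) → f (suc n) ≈ 0# → sumTo (suc n) f ≈ sumTo n f
  sumTo-dropLast n f f≈0 = trans (+-congˡ f≈0) (+-identityʳ _)

  natR-+ : ∀ m n → natR (m ℕ.+ n) ≈ natR m + natR n
  natR-+ zero    n = sym (+-identityˡ _)
  natR-+ (suc m) n = trans (+-congˡ (natR-+ m n)) (sym (+-assoc _ _ _))

  natR-* : ∀ m n → natR (m ℕ.* n) ≈ natR m * natR n
  natR-* zero    n = sym (zeroˡ _)
  natR-* (suc m) n = begin
    natR (n ℕ.+ m ℕ.* n)          ≈⟨ natR-+ n (m ℕ.* n) ⟩
    natR n + natR (m ℕ.* n)       ≈⟨ +-cong (sym (*-identityˡ _)) (natR-* m n) ⟩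
    1# * natR n + natR m * natR n ≈⟨ distribʳ _ _ _ ⟨
    (1# + natR m) * natR n        ∎

  natR-∸ : ∀ {n k} → k ≤ n → natR (n ∸ k) ≈ natR n - natR k
  natR-∸ {n} {k} k≤n = begin
    natR (n ∸ k)                        ≈⟨ +-identityʳ _ ⟨
    natR (n ∸ k) + 0#                   ≈⟨ +-congˡ (-‿inverseʳ (natR k)) ⟨
    natR (n ∸ k) + (natR k - natR k)    ≈⟨ +-assoc _ _ _ ⟨
    (natR (n ∸ k) + natR k) - natR k    ≈⟨ +-congʳ (natR-+ (n ∸ k) k) ⟨
    natR (n ∸ k ℕ.+ k) - natR k         ≡⟨ ≡.cong (λ m → natR m - natR k) (ℕ.m∸n+n≡m k≤n) ⟩
    natR n - natR k                     ∎

module SecondOrderRecurrences {c ℓ : Level} (R : CommutativeRing c ℓ) where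

  open import Data.Nat using (ℕ; zero; suc)
  open import Data.Product using (_×_; _,_; proj₁)
  open CommutativeRing R hiding (zero)
  open import Relation.Binary.Reasoning.Setoid setoid

  SatisfiesRecurrence : (L A B : ℕ → Carrier) → (ℕ → Carrier) → Set ℓ
  SatisfiesRecurrence L A B y = ∀ n → L n * y (suc (suc n)) ≈ A n * y (suc n) - B n * y n

  recurrence-unique : (L A B : ℕ → Carrier) →
                      (∀ n {z w} → L n * z ≈ L n * w → z ≈ w) →
                      ∀ {x y} → SatisfiesRecurrence L A B x → SatisfiesRecurrence L A B y →
                      x 0 ≈ y 0 → x 1 ≈ y 1 → ∀ n → x n ≈ y n
  recurrence-unique L A B cancel {x} {y} recˣ recʸ x₀≈y₀ x₁≈y₁ n = proj₁ (consecutive n)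
    where
    consecutive : ∀ n → x n ≈ y n × x (suc n) ≈ y (suc n)
    consecutive zero    = x₀≈y₀ , x₁≈y₁
    consecutive (suc n) with consecutive n
    ... | xₙ≈yₙ , xₙ₊₁≈yₙ₊₁ = xₙ₊₁≈yₙ₊₁ , cancel n (begin
      L n * x (suc (suc n))           ≈⟨ recˣ n ⟩
      A n * x (suc n) - B n * x n     ≈⟨ +-cong (*-congˡ xₙ₊₁≈yₙ₊₁) (-‿cong (*-congˡ xₙ≈yₙ)) ⟩
      A n * y (suc n) - B n * y n     ≈⟨ recʸ n ⟨
      L n * y (suc (suc n))           ∎)

module PowerCoefficients {c ℓ : Level} (R : CommutativeRing c ℓ) where

  open import Data.Nat as ℕ using (ℕ; zero; suc; _∸_; _≤_; _<_; s≤s)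
  import Data.Nat.Properties as ℕ
  open import Data.Nat.Combinatorics using (_C_; nCk+nC[k+1]≡[n+1]C[k+1])
  open import Data.Sum using (inj₁; inj₂)
  open import Relation.Binary.PropositionalEquality as ≡ using (_≡_)

  open CommutativeRing R hiding (zero)
  open Ops R
  open IntegerRingSolver R using (solve; κ; _:=_; _:+_; _:*_; _:-_; :-_; 2#)
  open FiniteSums R using (natR-+)
  open import Relation.Binary.Reasoning.Setoid setoid

  -- powCoeff n k = [xⁿ] (x - x²)ᵏ, computed from (x - x²)ᵏ⁺¹ = x (x - x²)ᵏ - x² (x - x²)ᵏ.
  powCoeff : ℕ → ℕ → Carrier
  powCoeff zero          zero    = 1#
  powCoeff (suc n)       zero    = 0#
  powCoeff zero          (suc k) = 0#
  powCoeff (suc zero)    (suc k) = powCoeff zero k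
  powCoeff (suc (suc n)) (suc k) = powCoeff (suc n) k - powCoeff n k

  powCoeff-vanish : ∀ {n k} → n < k → powCoeff n k ≈ 0#
  powCoeff-vanish {zero}        {suc k} _          = refl
  powCoeff-vanish {suc zero}    {suc k} (s≤s n<k) = powCoeff-vanish n<k
  powCoeff-vanish {suc (suc n)} {suc k} (s≤s n<k) = begin
    powCoeff (suc n) k - powCoeff n k
      ≈⟨ +-cong (powCoeff-vanish n<k) (-‿cong (powCoeff-vanish (ℕ.<-trans (ℕ.n<1+n n) n<k))) ⟩
    0# - 0#
      ≈⟨ -‿inverseʳ 0# ⟩
    0# ∎

  powCoeff-closed : ∀ {n k} → k ≤ n → powCoeff n k ≈ natR (k C (n ∸ k)) * pow (- 1#) (n ∸ k)
  powCoeff-closed {zero}  {zero}  _ = sym (trans (*-identityʳ _) (+-identityʳ 1#))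
  powCoeff-closed {suc n} {zero}  _ = sym (zeroˡ _)
  powCoeff-closed {suc zero} {suc zero} _ = sym (trans (*-identityʳ _) (+-identityʳ 1#))
  powCoeff-closed {suc zero} {suc (suc k)} (s≤s ())
  powCoeff-closed {suc (suc m)} {suc k} (s≤s k≤m+1) with ℕ.m≤n⇒m<n∨m≡n k≤m+1
  ... | inj₁ (s≤s k≤m) = begin
    powCoeff (suc m) k - powCoeff m k
      ≈⟨ +-cong (powCoeff-closed (ℕ.m≤n⇒m≤1+n k≤m)) (-‿cong (powCoeff-closed k≤m)) ⟩
    natR (k C (suc m ∸ k)) * pow (- 1#) (suc m ∸ k) - natR (k C j) * pow (- 1#) j
      ≡⟨ ≡.cong (λ i → natR (k C i) * pow (- 1#) i - natR (k C j) * pow (- 1#) j) m+1-k≡j+1 ⟩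
    natR (k C suc j) * (- 1# * pow (- 1#) j) - natR (k C j) * pow (- 1#) j
      ≈⟨ solve 3 (λ x y s → y :* (:- κ 1 :* s) :- x :* s := (x :+ y) :* (:- κ 1 :* s))
           refl (natR (k C j)) (natR (k C suc j)) (pow (- 1#) j) ⟩
    (natR (k C j) + natR (k C suc j)) * pow (- 1#) (suc j)
      ≈⟨ *-congʳ (natR-+ (k C j) (k C suc j)) ⟨
    natR (k C j ℕ.+ k C suc j) * pow (- 1#) (suc j)
      ≡⟨ ≡.cong (λ i → natR i * pow (- 1#) (suc j)) (nCk+nC[k+1]≡[n+1]C[k+1] k j) ⟩
    natR (suc k C suc j) * pow (- 1#) (suc j)
      ≡⟨ ≡.cong (λ i → natR (suc k C i) * pow (- 1#) i) m+1-k≡j+1 ⟨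
    natR (suc k C (suc m ∸ k)) * pow (- 1#) (suc m ∸ k) ∎
    where
    j = m ∸ k
    m+1-k≡j+1 : suc m ∸ k ≡ suc j
    m+1-k≡j+1 = ℕ.+-∸-assoc 1 k≤m
  ... | inj₂ ≡.refl = begin
    powCoeff (suc m) (suc m) - powCoeff m (suc m)
      ≈⟨ +-cong (powCoeff-closed {suc m} ℕ.≤-refl) (-‿cong (powCoeff-vanish (ℕ.n<1+n m))) ⟩
    natR (suc m C (m ∸ m)) * pow (- 1#) (m ∸ m) - 0#
      ≡⟨ ≡.cong (λ i → natR (suc m C i) * pow (- 1#) i - 0#) (ℕ.n∸n≡0 m) ⟩
    (1# + 0#) * 1# - 0#
      ≈⟨ trans (+-congˡ -0#≈0#) (+-identityʳ _) ⟩
    (1# + 0#) * 1#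
      ≡⟨ ≡.cong (λ i → natR (suc (suc m) C i) * pow (- 1#) i) (ℕ.n∸n≡0 m) ⟨
    natR (suc (suc m) C (suc m ∸ suc m)) * pow (- 1#) (suc m ∸ suc m) ∎
    where open import Algebra.Properties.Ring ring using (-0#≈0#)

  bothVanish : ∀ {x y} → x * 0# + y * 0# ≈ 0#
  bothVanish = trans (+-cong (zeroʳ _) (zeroʳ _)) (+-identityʳ 0#)

  -- The first-order relation between consecutive coefficients,
  --   (n + 1 - k) [xⁿ⁺¹] (x - x²)ᵏ + (2k - n) [xⁿ] (x - x²)ᵏ = 0,
  -- which is what makes the right-hand side summable by telescoping.
  powCoeff-rel : ∀ k n → (natR (suc n) - natR k) * powCoeff (suc n) k
                         + (2# * natR k - natR n) * powCoeff n k ≈ 0#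
  powCoeff-rel zero          zero          =
    solve 0 (((κ 1 :+ κ 0) :- κ 0) :* κ 0 :+ (κ 2 :* κ 0 :- κ 0) :* κ 1 := κ 0) refl
  powCoeff-rel zero          (suc n)       = bothVanish
  powCoeff-rel (suc zero)    zero          =
    solve 0 (((κ 1 :+ κ 0) :- (κ 1 :+ κ 0)) :* κ 1 :+ (κ 2 :* (κ 1 :+ κ 0) :- κ 0) :* κ 0 := κ 0) refl
  powCoeff-rel (suc (suc k)) zero          = bothVanish
  powCoeff-rel (suc k)       (suc zero)    = begin
    (natR 2 - natR (suc k)) * (C₁ - C₀) + (2# * natR (suc k) - natR 1) * C₀
      ≈⟨ solve 3 (λ K C₁ C₀ →
           ((κ 1 :+ (κ 1 :+ κ 0)) :- (κ 1 :+ K)) :* (C₁ :- C₀)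
             :+ (κ 2 :* (κ 1 :+ K) :- (κ 1 :+ κ 0)) :* C₀
           := (((κ 1 :+ κ 0) :- K) :* C₁ :+ (κ 2 :* K :- κ 0) :* C₀) :+ K :* C₀)
           refl (natR k) C₁ C₀ ⟩
    ((natR 1 - natR k) * C₁ + (2# * natR k - natR 0) * C₀) + natR k * C₀
      ≈⟨ +-cong (powCoeff-rel k zero) (constantTerm k) ⟩
    0# + 0#
      ≈⟨ +-identityʳ 0# ⟩
    0# ∎
    where
    C₁ = powCoeff 1 k
    C₀ = powCoeff 0 k
    constantTerm : ∀ k → natR k * powCoeff 0 k ≈ 0#
    constantTerm zero    = zeroˡ _
    constantTerm (suc k) = zeroʳ _
  powCoeff-rel (suc k)       (suc (suc n)) = begin
    (natR (3 ℕ.+ n) - natR (suc k)) * (C₂ - C₁) + (2# * natR (suc k) - natR (2 ℕ.+ n)) * (C₁ - C₀)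
      ≈⟨ solve 5 (λ N K C₂ C₁ C₀ →
           ((κ 1 :+ (κ 1 :+ (κ 1 :+ N))) :- (κ 1 :+ K)) :* (C₂ :- C₁)
             :+ (κ 2 :* (κ 1 :+ K) :- (κ 1 :+ (κ 1 :+ N))) :* (C₁ :- C₀)
           := (((κ 1 :+ (κ 1 :+ N)) :- K) :* C₂ :+ (κ 2 :* K :- (κ 1 :+ N)) :* C₁)
             :+ (:- κ 1) :* (((κ 1 :+ N) :- K) :* C₁ :+ (κ 2 :* K :- N) :* C₀))
           refl (natR n) (natR k) C₂ C₁ C₀ ⟩
    ((natR (2 ℕ.+ n) - natR k) * C₂ + (2# * natR k - natR (suc n)) * C₁)
    + (- 1#) * ((natR (suc n) - natR k) * C₁ + (2# * natR k - natR n) * C₀)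
      ≈⟨ +-cong (powCoeff-rel k (suc n)) (trans (*-congˡ (powCoeff-rel k n)) (zeroʳ _)) ⟩
    0# + 0#
      ≈⟨ +-identityʳ 0# ⟩
    0# ∎
    where
    C₂ = powCoeff (2 ℕ.+ n) k
    C₁ = powCoeff (suc n) k
    C₀ = powCoeff n k

module PositiveIntegersInvertible {c ℓ : Level} (R : CommutativeRing c ℓ)
         (inv : ℕ → CommutativeRing.Carrier R) (isInv : Ops.IsInvNat R inv) where

  open import Data.Nat using (suc)
  open CommutativeRing R
  open Ops R
  open IntegerRingSolver R using (solve; _:=_; _:*_; _:-_)
  open import Relation.Binary.Reasoning.Setoid setoid

  natR-suc-cancel : ∀ k {x y} → natR (suc k) * x ≈ natR (suc k) * y → x ≈ y
  natR-suc-cancel k {x} {y} eq = begin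
    x                          ≈⟨ *-identityˡ x ⟨
    1# * x                     ≈⟨ *-congʳ (isInv k) ⟨
    (inv k * natR (suc k)) * x ≈⟨ *-assoc _ _ _ ⟩
    inv k * (natR (suc k) * x) ≈⟨ *-congˡ eq ⟩
    inv k * (natR (suc k) * y) ≈⟨ *-assoc _ _ _ ⟨
    (inv k * natR (suc k)) * y ≈⟨ *-congʳ (isInv k) ⟩
    1# * y                     ≈⟨ *-identityˡ y ⟩
    y                          ∎

  binom-suc : ∀ a k → natR (suc k) * binom inv a (suc k) ≈ (a - natR k) * binom inv a k
  binom-suc a k = begin
    natR (suc k) * binom inv a (suc k)
      ≈⟨ solve 6 (λ N K a F I ι → N :* ((F :* (a :- K)) :* (I :* ι))
                                 := (a :- K) :* (F :* I) :* (ι :* N)) refl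
           (natR (suc k)) (natR k) a (falling a k) (invFact inv k) (inv k) ⟩
    (a - natR k) * binom inv a k * (inv k * natR (suc k))
      ≈⟨ *-congˡ (isInv k) ⟩
    (a - natR k) * binom inv a k * 1#
      ≈⟨ *-identityʳ _ ⟩
    (a - natR k) * binom inv a k ∎

module Sequences {c ℓ : Level} (R : CommutativeRing c ℓ)
         (inv : ℕ → CommutativeRing.Carrier R) (isInv : Ops.IsInvNat R inv)
         (a : CommutativeRing.Carrier R) where

  open import Data.Nat using (suc)
  open CommutativeRing R
  open Ops R
  open IntegerRingSolver R using (solve; κ; _:=_; _:+_; _:*_; _:-_; :-_; 2#; 4#)
  open PositiveIntegersInvertible R inv isInv
  open import Relation.Binary.Reasoning.Setoid setoid

  b : Carrier
  b = - 1# - a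

  -- The products (a - k)(b - k) = k² + k - Λ depend on a only through Λ.
  Λ : Carrier
  Λ = a * a + a

  u : ℕ → Carrier
  u k = binom inv a k * binom inv b k

  u-zero : u 0 ≈ 1#
  u-zero = trans (*-cong (*-identityˡ 1#) (*-identityˡ 1#)) (*-identityˡ 1#)

  u-suc : ∀ k → natR (suc k) * natR (suc k) * u (suc k) ≈ (natR k * natR k + natR k - Λ) * u k
  u-suc k = begin
    natR (suc k) * natR (suc k) * (binom inv a (suc k) * binom inv b (suc k))
      ≈⟨ solve 3 (λ N x y → N :* N :* (x :* y) := (N :* x) :* (N :* y)) refl _ _ _ ⟩
    (natR (suc k) * binom inv a (suc k)) * (natR (suc k) * binom inv b (suc k))
      ≈⟨ *-cong (binom-suc a k) (binom-suc b k) ⟩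
    ((a - K) * binom inv a k) * ((b - K) * binom inv b k)
      ≈⟨ solve 4 (λ a K x y → ((a :- K) :* x) :* (((:- κ 1) :- a :- K) :* y)
                            := (K :* K :+ K :- (a :* a :+ a)) :* (x :* y)) refl a K _ _ ⟩
    (K * K + K - Λ) * u k ∎
    where K = natR k

  leading growth decay : ℕ → Carrier
  leading n = natR (suc (suc n)) * natR (suc (suc n)) * natR (suc (suc n))
  growth  n = (2# * M + 1#) * (M * (M + 1#) - 2# * Λ)  where M = natR (suc n)
  decay   n = M * (M * M - 1# - 4# * Λ)                where M = natR (suc n)

  leading-cancel : ∀ n {x y} → leading n * x ≈ leading n * y → x ≈ y
  leading-cancel n {x} {y} eq =
    natR-suc-cancel (suc n) (natR-suc-cancel (suc n) (natR-suc-cancel (suc n) (begin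
      N * (N * (N * x))   ≈⟨ *-assoc N N (N * x) ⟨
      N * N * (N * x)     ≈⟨ *-assoc (N * N) N x ⟨
      N * N * N * x       ≈⟨ eq ⟩
      N * N * N * y       ≈⟨ *-assoc (N * N) N y ⟩
      N * N * (N * y)     ≈⟨ *-assoc N N (N * y) ⟩
      N * (N * (N * y))   ∎)))
    where N = natR (suc (suc n))

module LeftSide {c ℓ : Level} (R : CommutativeRing c ℓ)
         (inv : ℕ → CommutativeRing.Carrier R) (isInv : Ops.IsInvNat R inv)
         (a : CommutativeRing.Carrier R) where

  open import Data.Nat using (suc; _∸_; _≤_)
  import Data.Nat.Properties as ℕ
  import Relation.Binary.PropositionalEquality as ≡

  open CommutativeRing R
  open Ops R
  open IntegerRingSolver R
    using (solve; κ; _:=_; _:+_; _:*_; _:-_; :-_; 2#; 3#; 4#; 6#;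
           ≈-fromDifference; scaledDifference≈0)
  open SecondOrderRecurrences R using (SatisfiesRecurrence)
  open FiniteSums R
  open Sequences R inv isInv a
  open import Relation.Binary.Reasoning.Setoid setoid

  X : ℕ → ℕ → Carrier
  X n k = u k * u (n ∸ k)

  P : ℕ → Carrier
  P n = sumTo n (X n)

  moment : (ℕ → Carrier) → ℕ → Carrier
  moment w n = sumTo n (λ k → w k * X n k)

  Q S T : ℕ → Carrier
  Q = moment natR
  S = moment (λ k → natR k * natR k)
  T = moment (λ k → natR k * natR k * natR k)

  moment-reflect : ∀ n (w : ℕ → Carrier) → moment w n ≈ moment (λ k → w (n ∸ k)) n
  moment-reflect n w = trans (sumTo-reverse n _) (sumTo-cong≤ n reflected)
    where
    reflected : ∀ k → k ≤ n → w (n ∸ k) * X n (n ∸ k) ≈ w (n ∸ k) * X n k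
    reflected k k≤n = *-congˡ (trans (*-comm _ _)
                        (*-congʳ (reflexive (≡.cong u (ℕ.m∸[m∸n]≡n k≤n)))))

  -- Shifting the summation index with the recurrence for u: a weight
  -- containing the factor k² turns into the factor k² + k - Λ.
  moment-shift : ∀ n (w : ℕ → Carrier) →
                 moment (λ k → w k * (natR k * natR k)) (suc n)
                 ≈ moment (λ k → w (suc k) * (natR k * natR k + natR k - Λ)) n
  moment-shift n w = begin
    moment (λ k → w k * (natR k * natR k)) (suc n)
      ≈⟨ sumTo-shift n _ ⟩
    w 0 * (0# * 0#) * X (suc n) 0 + sumTo n shifted
      ≈⟨ +-cong (trans (*-congʳ (trans (*-congˡ (zeroˡ 0#)) (zeroʳ _))) (zeroˡ _))
                (sumTo-cong n step) ⟩
    0# + moment (λ k → w (suc k) * (natR k * natR k + natR k - Λ)) n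
      ≈⟨ +-identityˡ _ ⟩
    moment (λ k → w (suc k) * (natR k * natR k + natR k - Λ)) n ∎
    where
    shifted : ℕ → Carrier
    shifted k = w (suc k) * (natR (suc k) * natR (suc k)) * X (suc n) (suc k)
    step : ∀ k → shifted k ≈ w (suc k) * (natR k * natR k + natR k - Λ) * X n k
    step k = begin
      w (suc k) * (natR (suc k) * natR (suc k)) * (u (suc k) * u (n ∸ k))
        ≈⟨ solve 4 (λ w N x y → w :* (N :* N) :* (x :* y) := w :* (N :* N :* x) :* y) refl
             (w (suc k)) (natR (suc k)) (u (suc k)) (u (n ∸ k)) ⟩
      w (suc k) * (natR (suc k) * natR (suc k) * u (suc k)) * u (n ∸ k)
        ≈⟨ *-congʳ (*-congˡ (u-suc k)) ⟩
      w (suc k) * ((natR k * natR k + natR k - Λ) * u k) * u (n ∸ k)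
        ≈⟨ solve 4 (λ w c x y → w :* (c :* x) :* y := w :* c :* (x :* y)) refl
             (w (suc k)) (natR k * natR k + natR k - Λ) (u k) (u (n ∸ k)) ⟩
      w (suc k) * (natR k * natR k + natR k - Λ) * X n k ∎

  Q-reflect : ∀ n → Q n + Q n ≈ natR n * P n
  Q-reflect n = begin
    Q n + Q n
      ≈⟨ +-congˡ (moment-reflect n natR) ⟩
    Q n + moment (λ k → natR (n ∸ k)) n
      ≈⟨ +-congˡ (sumTo-cong≤ n (λ k k≤n → *-congʳ (natR-∸ k≤n))) ⟩
    Q n + moment (λ k → N - natR k) n
      ≈⟨ sumTo-+ n _ _ ⟨
    sumTo n (λ k → natR k * X n k + (N - natR k) * X n k)
      ≈⟨ sumTo-cong n (λ k → solve 3 (λ N K x → K :* x :+ (N :- K) :* x := N :* x) refl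
                                     N (natR k) (X n k)) ⟩
    sumTo n (λ k → N * X n k)
      ≈⟨ sumTo-*ˡ n N (X n) ⟩
    N * P n ∎
    where N = natR n

  T-reflect : ∀ n → T n + T n ≈ natR n * natR n * natR n * P n
                                 + (- (3# * natR n * natR n)) * Q n + 3# * natR n * S n
  T-reflect n = begin
    T n + T n
      ≈⟨ +-congˡ (moment-reflect n _) ⟩
    T n + moment (λ k → natR (n ∸ k) * natR (n ∸ k) * natR (n ∸ k)) n
      ≈⟨ +-congˡ (sumTo-cong≤ n (λ k k≤n → *-congʳ
           (*-cong (*-cong (natR-∸ k≤n) (natR-∸ k≤n)) (natR-∸ k≤n)))) ⟩
    T n + moment (λ k → (N - natR k) * (N - natR k) * (N - natR k)) n
      ≈⟨ sumTo-+ n _ _ ⟨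
    sumTo n (λ k → natR k * natR k * natR k * X n k
                   + (N - natR k) * (N - natR k) * (N - natR k) * X n k)
      ≈⟨ sumTo-cong n (λ k → expand (natR k) (X n k)) ⟩
    sumTo n (λ k → N * N * N * X n k + (- (3# * N * N)) * (natR k * X n k)
                   + 3# * N * (natR k * natR k * X n k))
      ≈⟨ sumTo-linear₃ n _ _ _ _ _ _ ⟩
    N * N * N * P n + (- (3# * N * N)) * Q n + 3# * N * S n ∎
    where
    N = natR n
    expand : ∀ K x → K * K * K * x + (N - K) * (N - K) * (N - K) * x
                     ≈ N * N * N * x + (- (3# * N * N)) * (K * x) + 3# * N * (K * K * x)
    expand = solve 3 (λ N K x →
      K :* K :* K :* x :+ (N :- K) :* (N :- K) :* (N :- K) :* x
      := N :* N :* N :* x :+ (:- (κ 3 :* N :* N)) :* (K :* x) :+ κ 3 :* N :* (K :* K :* x))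
      refl N

  -- Index shifts for S and T, from moment-shift with weights 1 and k - 1.
  S-suc : ∀ n → S (suc n) ≈ S n + Q n - Λ * P n
  S-suc n = begin
    S (suc n)
      ≈⟨ sumTo-cong (suc n) (λ k → *-congʳ (*-identityˡ _)) ⟨
    moment (λ k → 1# * (natR k * natR k)) (suc n)
      ≈⟨ moment-shift n (λ _ → 1#) ⟩
    moment (λ k → 1# * (natR k * natR k + natR k - Λ)) n
      ≈⟨ sumTo-cong n (λ k → solve 3 (λ K l x →
           κ 1 :* (K :* K :+ K :- l) :* x
           := κ 1 :* (K :* K :* x) :+ κ 1 :* (K :* x) :+ (:- l) :* x)
           refl (natR k) Λ (X n k)) ⟩
    sumTo n (λ k → 1# * (natR k * natR k * X n k) + 1# * (natR k * X n k) + (- Λ) * X n k)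
      ≈⟨ sumTo-linear₃ n _ _ _ _ _ _ ⟩
    1# * S n + 1# * Q n + (- Λ) * P n
      ≈⟨ solve 4 (λ s q l p → κ 1 :* s :+ κ 1 :* q :+ (:- l) :* p := s :+ q :- l :* p)
           refl (S n) (Q n) Λ (P n) ⟩
    S n + Q n - Λ * P n ∎

  T-suc : ∀ n → T (suc n) - S (suc n) ≈ T n + S n - Λ * Q n
  T-suc n = begin
    T (suc n) - S (suc n)
      ≈⟨ sumTo-- (suc n) _ _ ⟨
    sumTo (suc n) (λ k → natR k * natR k * natR k * X (suc n) k - natR k * natR k * X (suc n) k)
      ≈⟨ sumTo-cong (suc n) (λ k → solve 2 (λ K x →
           K :* K :* K :* x :- K :* K :* x := (K :- κ 1) :* (K :* K) :* x)
           refl (natR k) (X (suc n) k)) ⟩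
    moment (λ k → (natR k - 1#) * (natR k * natR k)) (suc n)
      ≈⟨ moment-shift n (λ k → natR k - 1#) ⟩
    moment (λ k → (natR (suc k) - 1#) * (natR k * natR k + natR k - Λ)) n
      ≈⟨ sumTo-cong n (λ k → solve 3 (λ K l x →
           ((κ 1 :+ K) :- κ 1) :* (K :* K :+ K :- l) :* x
           := κ 1 :* (K :* K :* K :* x) :+ κ 1 :* (K :* K :* x) :+ (:- l) :* (K :* x))
           refl (natR k) Λ (X n k)) ⟩
    sumTo n (λ k → 1# * (natR k * natR k * natR k * X n k) + 1# * (natR k * natR k * X n k)
                   + (- Λ) * (natR k * X n k))
      ≈⟨ sumTo-linear₃ n _ _ _ _ _ _ ⟩
    1# * T n + 1# * S n + (- Λ) * Q n
      ≈⟨ solve 4 (λ t s l q → κ 1 :* t :+ κ 1 :* s :+ (:- l) :* q := t :+ s :- l :* q)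
           refl (T n) (S n) Λ (Q n) ⟩
    T n + S n - Λ * Q n ∎

  -- The cubic appearing in the first-order system satisfied by P and S.
  cubic : ℕ → Carrier
  cubic n = N * N * N + 3# * N * N + N - 2# * Λ * (2# * N + 1#)  where N = natR n

  -- Eliminating Q and T between consecutive indices.
  P-step : ∀ n → natR (suc n) * natR (suc n) * natR (suc n) * P (suc n)
                 ≈ cubic n * P n - (S n + S n)
  P-step n = ≈-fromDifference (begin
    N' * N' * N' * P' - (cubic n * P₀ - (S₀ + S₀))
      ≈⟨ solve 10 (λ N l P' Q' S' T' P Q S T → let N' = κ 1 :+ N in
            N' :* N' :* N' :* P'
              :- ((N :* N :* N :+ κ 3 :* N :* N :+ N :- κ 2 :* l :* (κ 2 :* N :+ κ 1)) :* P :- (S :+ S))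
            := (:- (κ 3 :* N' :* N')) :* ((Q' :+ Q') :- N' :* P')
            :+ κ 2 :* ((T' :+ T')
                       :- (N' :* N' :* N' :* P' :+ (:- (κ 3 :* N' :* N')) :* Q' :+ κ 3 :* N' :* S'))
            :+ (κ 3 :* N :* N :+ κ 3 :* N :+ κ 1 :+ κ 2 :* l) :* ((Q :+ Q) :- N :* P)
            :+ (:- κ 2) :* ((T :+ T) :- (N :* N :* N :* P :+ (:- (κ 3 :* N :* N)) :* Q :+ κ 3 :* N :* S))
            :+ (κ 6 :* N :+ κ 2) :* (S' :- (S :+ Q :- l :* P))
            :+ (:- κ 4) :* ((T' :- S') :- (T :+ S :- l :* Q)))
            refl N Λ P' Q' S' T' P₀ Q₀ S₀ T₀ ⟩
    (- (3# * N' * N')) * ((Q' + Q') - N' * P')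
    + 2# * ((T' + T') - (N' * N' * N' * P' + (- (3# * N' * N')) * Q' + 3# * N' * S'))
    + (3# * N * N + 3# * N + 1# + 2# * Λ) * ((Q₀ + Q₀) - N * P₀)
    + (- 2#) * ((T₀ + T₀) - (N * N * N * P₀ + (- (3# * N * N)) * Q₀ + 3# * N * S₀))
    + (6# * N + 2#) * (S' - (S₀ + Q₀ - Λ * P₀))
    + (- 4#) * ((T' - S') - (T₀ + S₀ - Λ * Q₀))
      ≈⟨ +-cong (+-cong (+-cong (+-cong (+-cong
           (scaledDifference≈0 _ (Q-reflect (suc n)))
           (scaledDifference≈0 _ (T-reflect (suc n))))
           (scaledDifference≈0 _ (Q-reflect n)))
           (scaledDifference≈0 _ (T-reflect n)))
           (scaledDifference≈0 _ (S-suc n)))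
           (scaledDifference≈0 _ (T-suc n)) ⟩
    0# + 0# + 0# + 0# + 0# + 0#
      ≈⟨ solve 0 (κ 0 :+ κ 0 :+ κ 0 :+ κ 0 :+ κ 0 :+ κ 0 := κ 0) refl ⟩
    0# ∎)
    where
    N = natR n
    N' = natR (suc n)
    P' = P (suc n)
    Q' = Q (suc n)
    S' = S (suc n)
    T' = T (suc n)
    P₀ = P n
    Q₀ = Q n
    S₀ = S n
    T₀ = T n

  P-recurrence : SatisfiesRecurrence leading growth decay P
  P-recurrence n = ≈-fromDifference (begin
    leading n * P (suc (suc n)) - (growth n * P (suc n) - decay n * P n)
      ≈⟨ solve 8 (λ N l P'' P' P S' S Q →
           let M = κ 1 :+ N ; M' = κ 1 :+ M
               cub = λ x → x :* x :* x :+ κ 3 :* x :* x :+ x :- κ 2 :* l :* (κ 2 :* x :+ κ 1) in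
           M' :* M' :* M' :* P'' :- ((κ 2 :* M :+ κ 1) :* (M :* (M :+ κ 1) :- κ 2 :* l) :* P'
                                     :- M :* (M :* M :- κ 1 :- κ 4 :* l) :* P)
           := κ 1 :* (M' :* M' :* M' :* P'' :- (cub M :* P' :- (S' :+ S')))
           :+ (:- κ 1) :* (M :* M :* M :* P' :- (cub N :* P :- (S :+ S)))
           :+ (:- κ 2) :* (S' :- (S :+ Q :- l :* P))
           :+ (:- κ 1) :* ((Q :+ Q) :- N :* P))
           refl (natR n) Λ (P (suc (suc n))) (P (suc n)) (P n) (S (suc n)) (S n) (Q n) ⟩
    1# * (leading n * P (suc (suc n)) - (cubic (suc n) * P (suc n) - (S (suc n) + S (suc n))))
    + (- 1#) * (natR (suc n) * natR (suc n) * natR (suc n) * P (suc n) - (cubic n * P n - (S n + S n)))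
    + (- 2#) * (S (suc n) - (S n + Q n - Λ * P n))
    + (- 1#) * ((Q n + Q n) - natR n * P n)
      ≈⟨ +-cong (+-cong (+-cong
           (scaledDifference≈0 _ (P-step (suc n)))
           (scaledDifference≈0 _ (P-step n)))
           (scaledDifference≈0 _ (S-suc n)))
           (scaledDifference≈0 _ (Q-reflect n)) ⟩
    0# + 0# + 0# + 0#
      ≈⟨ solve 0 (κ 0 :+ κ 0 :+ κ 0 :+ κ 0 := κ 0) refl ⟩
    0# ∎)

  P-zero : P 0 ≈ 1#
  P-zero = trans (*-cong u-zero u-zero) (*-identityˡ 1#)

  P-one : P 1 ≈ 2# * u 1
  P-one = begin
    u 0 * u 1 + u 1 * u 0    ≈⟨ +-cong (*-congʳ u-zero) (*-congˡ u-zero) ⟩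
    1# * u 1 + u 1 * 1#      ≈⟨ solve 1 (λ x → κ 1 :* x :+ x :* κ 1 := κ 2 :* x) refl (u 1) ⟩
    2# * u 1                 ∎

module RightSide {c ℓ : Level} (R : CommutativeRing c ℓ)
         (inv : ℕ → CommutativeRing.Carrier R) (isInv : Ops.IsInvNat R inv)
         (a : CommutativeRing.Carrier R) where

  open import Data.Nat as ℕ using (suc; _<_)
  import Data.Nat.Properties as ℕ
  import Relation.Binary.PropositionalEquality as ≡

  open CommutativeRing R
  open Ops R
  open BinomialCoefficients using (C-central)
  open IntegerRingSolver R
    using (solve; κ; _:=_; _:+_; _:*_; _:-_; :-_; 2#; 3#;
           ≈-fromDifference; scaledDifference≈0; scaled≈0)
  open FiniteSums R
  open SecondOrderRecurrences R using (SatisfiesRecurrence)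
  open PositiveIntegersInvertible R inv isInv
  open Sequences R inv isInv a using (Λ; u; u-zero; u-suc; leading; growth; decay)
  open PowerCoefficients R
  open import Relation.Binary.Reasoning.Setoid setoid

  v : ℕ → Carrier
  v k = natR ((2 ℕ.* k) C k) * u k

  v-suc : ∀ k → natR (suc k) * natR (suc k) * natR (suc k) * v (suc k)
                ≈ 2# * (2# * natR k + 1#) * (natR k * natR k + natR k - Λ) * v k
  v-suc k = begin
    natR (suc k) * natR (suc k) * natR (suc k) * (natR C′ * u (suc k))
      ≈⟨ solve 3 (λ N c x → N :* N :* N :* (c :* x) := (N :* c) :* (N :* N :* x))
           refl (natR (suc k)) (natR C′) (u (suc k)) ⟩
    (natR (suc k) * natR C′) * (natR (suc k) * natR (suc k) * u (suc k))
      ≈⟨ *-cong (sym (natR-* (suc k) C′)) (u-suc k) ⟩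
    natR (suc k ℕ.* C′) * ((K * K + K - Λ) * u k)
      ≡⟨ ≡.cong (λ m → natR m * ((K * K + K - Λ) * u k)) (C-central k) ⟩
    natR (2 ℕ.* suc (2 ℕ.* k) ℕ.* C₀) * ((K * K + K - Λ) * u k)
      ≈⟨ *-congʳ (trans (natR-* (2 ℕ.* suc (2 ℕ.* k)) C₀)
                        (*-congʳ (trans (natR-* 2 (suc (2 ℕ.* k))) (*-congˡ (+-congˡ (natR-* 2 k)))))) ⟩
    (natR 2 * (1# + natR 2 * K) * natR C₀) * ((K * K + K - Λ) * u k)
      ≈⟨ solve 4 (λ K l c x → let two = κ 1 :+ (κ 1 :+ κ 0) in
           (two :* (κ 1 :+ two :* K) :* c) :* ((K :* K :+ K :- l) :* x)
           := κ 2 :* (κ 2 :* K :+ κ 1) :* (K :* K :+ K :- l) :* (c :* x))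
           refl K Λ (natR C₀) (u k) ⟩
    2# * (2# * K + 1#) * (K * K + K - Λ) * v k ∎
    where
    K = natR k
    C′ = (2 ℕ.* suc k) C suc k
    C₀ = (2 ℕ.* k) C k

  H : ℕ → ℕ → Carrier
  H n k = v k * powCoeff n k

  r : ℕ → Carrier
  r n = sumTo n (H n)

  H-vanish : ∀ {n k} → n < k → H n k ≈ 0#
  H-vanish n<k = scaled≈0 _ (powCoeff-vanish n<k)

  -- Creative telescoping: the recurrence operator applied to the summand
  -- H(·, k) is a difference in k, with certificate G.
  recurrenceTerm certificateTerm : ℕ → ℕ → Carrier
  recurrenceTerm p k = leading p * H (2 ℕ.+ p) k + (- growth p) * H (suc p) k + decay p * H p k
  certificateTerm p k = (- natR (2 ℕ.+ p)) * (natR k * natR k) * H (2 ℕ.+ p) k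

  recurrenceTerm-telescopes : ∀ p k →
    recurrenceTerm p k ≈ certificateTerm p (suc k) - certificateTerm p k
  recurrenceTerm-telescopes p k = ≈-fromDifference (natR-suc-cancel k (begin
    natR (suc k) * (recurrenceTerm p k - (certificateTerm p (suc k) - certificateTerm p k))
      ≈⟨ solve 8 (λ P K l V V₁ C₂ C₁ C₀ → let M = κ 1 :+ P ; M' = κ 1 :+ M in
           (κ 1 :+ K) :* (M' :* M' :* M' :* (V :* C₂)
                          :+ (:- ((κ 2 :* M :+ κ 1) :* (M :* (M :+ κ 1) :- κ 2 :* l))) :* (V :* C₁)
                          :+ M :* (M :* M :- κ 1 :- κ 4 :* l) :* (V :* C₀)
                          :- ((:- M') :* ((κ 1 :+ K) :* (κ 1 :+ K)) :* (V₁ :* (C₁ :- C₀))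
                              :- (:- M') :* (K :* K) :* (V :* C₂)))
           := (M' :* (C₁ :- C₀)) :* ((κ 1 :+ K) :* (κ 1 :+ K) :* (κ 1 :+ K) :* V₁
                                     :- κ 2 :* (κ 2 :* K :+ κ 1) :* (K :* K :+ K :- l) :* V)
           :+ ((K :+ κ 1) :* (M :+ κ 1) :* (M :+ κ 1 :+ K) :* V)
                :* ((M' :- K) :* C₂ :+ (κ 2 :* K :- M) :* C₁)
           :+ ((κ 2 :* l :- κ 2 :* K :- κ 2 :* K :* K :- M :- κ 3 :* M :* K :- κ 2 :* M :* K :* K
                 :- M :* M :- M :* M :* K) :* V)
                :* ((M :- K) :* C₁ :+ (κ 2 :* K :- P) :* C₀))
           refl (natR p) (natR k) Λ (v k) (v (suc k)) C₂ C₁ C₀ ⟩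
    (natR (2 ℕ.+ p) * (C₁ - C₀)) * (natR (suc k) * natR (suc k) * natR (suc k) * v (suc k)
                                    - 2# * (2# * K + 1#) * (K * K + K - Λ) * v k)
    + ((K + 1#) * (M + 1#) * (M + 1# + K) * v k)
        * ((natR (2 ℕ.+ p) - K) * C₂ + (2# * K - M) * C₁)
    + ((2# * Λ - 2# * K - 2# * K * K - M - 3# * M * K - 2# * M * K * K - M * M - M * M * K) * v k)
        * ((M - K) * C₁ + (2# * K - natR p) * C₀)
      ≈⟨ +-cong (+-cong (scaledDifference≈0 _ (v-suc k))
                        (scaled≈0 _ (powCoeff-rel k (suc p))))
                (scaled≈0 _ (powCoeff-rel k p)) ⟩
    0# + 0# + 0#
      ≈⟨ trans (+-identityʳ _) (+-identityʳ 0#) ⟩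
    0#
      ≈⟨ zeroʳ _ ⟨
    natR (suc k) * 0# ∎))
    where
    K = natR k
    M = natR (suc p)
    C₂ = powCoeff (2 ℕ.+ p) k
    C₁ = powCoeff (suc p) k
    C₀ = powCoeff p k

  -- Summing the telescoping identity over k ≤ p + 2.
  r-recurrence : SatisfiesRecurrence leading growth decay r
  r-recurrence p = ≈-fromDifference (begin
    leading p * r (2 ℕ.+ p) - (growth p * r (suc p) - decay p * r p)
      ≈⟨ solve 6 (λ L A B x y z → L :* x :- (A :* y :- B :* z) := L :* x :+ (:- A) :* y :+ B :* z)
           refl (leading p) (growth p) (decay p) (r (2 ℕ.+ p)) (r (suc p)) (r p) ⟩
    leading p * r (2 ℕ.+ p) + (- growth p) * r (suc p) + decay p * r p
      ≈⟨ +-cong (+-congˡ (*-congˡ padded₁)) (*-congˡ padded₀) ⟨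
    leading p * r (2 ℕ.+ p) + (- growth p) * sumTo (2 ℕ.+ p) (H (suc p))
      + decay p * sumTo (2 ℕ.+ p) (H p)
      ≈⟨ sumTo-linear₃ (2 ℕ.+ p) _ _ _ _ _ _ ⟨
    sumTo (2 ℕ.+ p) (recurrenceTerm p)
      ≈⟨ sumTo-cong (2 ℕ.+ p) (recurrenceTerm-telescopes p) ⟩
    sumTo (2 ℕ.+ p) (λ k → certificateTerm p (suc k) - certificateTerm p k)
      ≈⟨ sumTo-telescope (2 ℕ.+ p) (certificateTerm p) ⟩
    certificateTerm p (3 ℕ.+ p) - certificateTerm p 0
      ≈⟨ +-cong (scaled≈0 _ (H-vanish (ℕ.n<1+n (2 ℕ.+ p))))
                (-‿cong (trans (*-congʳ (trans (*-congˡ (zeroˡ 0#)) (zeroʳ _))) (zeroˡ _))) ⟩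
    0# - 0#
      ≈⟨ -‿inverseʳ 0# ⟩
    0# ∎)
    where
    padded₁ : sumTo (2 ℕ.+ p) (H (suc p)) ≈ r (suc p)
    padded₁ = sumTo-dropLast (suc p) (H (suc p)) (H-vanish (ℕ.n<1+n (suc p)))
    padded₀ : sumTo (2 ℕ.+ p) (H p) ≈ r p
    padded₀ = trans (sumTo-dropLast (suc p) (H p) (H-vanish (ℕ.m<n⇒m<1+n (ℕ.n<1+n p))))
                    (sumTo-dropLast p (H p) (H-vanish (ℕ.n<1+n p)))

  r-zero : r 0 ≈ 1#
  r-zero = trans (solve 1 (λ x → (κ 1 :+ κ 0) :* x :* κ 1 := x) refl (u 0)) u-zero

  r-one : r 1 ≈ 2# * u 1
  r-one = solve 2 (λ x y → x :* κ 0 :+ ((κ 1 :+ (κ 1 :+ κ 0)) :* y) :* κ 1 := κ 2 :* y)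
                  refl (v 0) (u 1)

lemma2p2 : ∀ {c ℓ : Level} (R : CommutativeRing c ℓ) →
           let open CommutativeRing R in
           let open Ops R in
           (inv : ℕ → Carrier) → IsInvNat inv →
           (a : Carrier) (n : ℕ) →
           sumTo n (λ k → binom inv a k * binom inv (- 1# - a) k
                           * binom inv a (n ∸ k) * binom inv (- 1# - a) (n ∸ k))
           ≈ sumTo n (λ k → natR ((2 *ℕ k) C k) * binom inv a k * binom inv (- 1# - a) k
                           * natR (k C (n ∸ k)) * pow (- 1#) (n ∸ k))
lemma2p2 R inv isInv a n = begin
  sumTo n (λ k → binom inv a k * binom inv b k * binom inv a (n ∸ k) * binom inv b (n ∸ k))
    ≈⟨ sumTo-cong n (λ k → *-assoc _ _ _) ⟩
  P n
    ≈⟨ recurrence-unique leading growth decay leading-cancel P-recurrence r-recurrence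
         (trans P-zero (sym r-zero)) (trans P-one (sym r-one)) n ⟩
  r n
    ≈⟨ sumTo-cong≤ n (λ k k≤n → trans (*-congˡ (powCoeff-closed k≤n))
         (solve 5 (λ c x y d s → (c :* (x :* y)) :* (d :* s) := c :* x :* y :* d :* s)
                refl _ _ _ _ _)) ⟩
  sumTo n (λ k → natR ((2 *ℕ k) C k) * binom inv a k * binom inv b k
                 * natR (k C (n ∸ k)) * pow (- 1#) (n ∸ k)) ∎
  where
  open CommutativeRing R
  open Ops R
  open IntegerRingSolver R using (solve; _:=_; _:*_)
  open FiniteSums R using (sumTo-cong; sumTo-cong≤)
  open SecondOrderRecurrences R using (recurrence-unique)
  open Sequences R inv isInv a using (b; leading; growth; decay; leading-cancel)
  open LeftSide R inv isInv a using (P; P-zero; P-one; P-recurrence)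
  open RightSide R inv isInv a using (r; r-zero; r-one; r-recurrence)
  open PowerCoefficients R using (powCoeff-closed)
  open import Relation.Binary.Reasoning.Setoid setoid
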